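{- Let $p$ be an even positive integer, $\mu=\frac{p^2}{4}+2p+2$, $\gamma=2\mu-\left(\frac p2+4\right)$ and $S(p)=\langle \mu,\gamma,\gamma+1\rangle_{p\mu}$. Then the genus of $S(p)$ is $$|\mathbb N\setminus S(p)|=p\left(\frac{5}{24}p^2+\frac{13}{8}p+\frac{11}{12}\right).$$
   Context: A numerical semigroup is a submonoid of $(\mathbb N,+)$ with finite complement; its genus is the number of elements of $\mathbb N$ not in it. For integers $a_1,\dots,a_r$ and $t$, $\langle a_1,\dots,a_r\rangle_t$ denotes the smallest numerical semigroup containing $a_1,\dots,a_r$ and all integers $\ge t$. -}

module Defs where

open import Data.Nat using (ℕ; zero; suc; _+_; _*_; _∸_; _≤_; _<_)
open import Data.Nat.DivMod using (_/_)
open import Data.List using (List; length; _∷_; [])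
open import Data.List.Membership.Propositional using (_∈_)
open import Data.List.Relation.Unary.Unique.Propositional using (Unique)
open import Data.Product using (∃; _×_)
open import Relation.Nullary using (¬_)
open import Relation.Binary.PropositionalEquality using (_≡_)

-- ⟨ a₁,…,a_r ⟩_t : the smallest submonoid of (ℕ,+) containing the a_i and all
-- integers ≥ t  (inductively generated, hence the smallest such set).
data ⟨_⟩[_] (gens : List ℕ) (t : ℕ) : ℕ → Set where
  zero∈ : ⟨ gens ⟩[ t ] 0
  gen∈  : ∀ {a} → a ∈ gens → ⟨ gens ⟩[ t ] a
  ≥t∈   : ∀ {n} → t ≤ n → ⟨ gens ⟩[ t ] n
  +∈    : ∀ {m n} → ⟨ gens ⟩[ t ] m → ⟨ gens ⟩[ t ] n → ⟨ gens ⟩[ t ] (m + n)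

HasGenus : (ℕ → Set) → ℕ → Set
HasGenus S g = ∃ λ (L : List ℕ) →
  Unique L × (∀ n → n ∈ L → ¬ S n) × (∀ n → ¬ S n → n ∈ L) × length L ≡ g

μ : ℕ → ℕ
μ p = (p * p) / 4 + 2 * p + 2

γ : ℕ → ℕ
γ p = 2 * μ p ∸ (p / 2 + 4)

S : ℕ → ℕ → Set
S p = ⟨ μ p ∷ γ p ∷ suc (γ p) ∷ [] ⟩[ p * μ p ]

-- Write p = 2k and q = k + 4, so that μ = kq + 2 and γ + q = 2μ.  An element
-- aμ + bγ + c(γ+1) of the monoid generated by μ, γ, γ+1 is then Aμ − Jq + C with
-- J = b + c, A = a + 2J and C = c ≤ J.  Below t = pμ this forces J ≤ k, hence Jq < μ,
-- and writing n = mμ + r with r < μ, n ∈ S(p) iff r = 0 or r + Jq ∈ [μ, μ + J] for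
-- some 1 ≤ J ≤ ⌈m/2⌉.  These windows are disjoint intervals of J + 1 residues, so
-- block m contains 1 + h(h+3)/2 elements of S(p), h = ⌈m/2⌉; blocks 2a and 2a+1
-- together contain (a+2)², and the gaps are the t − k(2k²+9k+13)/6 remaining numbers.
module Submission where

open import Defs
open import Level using (0ℓ)
open import Function using (_∘_)
open import Data.Empty using (⊥-elim)
open import Data.Bool using (if_then_else_)
open import Data.Product using (∃-syntax; _×_; _,_)
open import Data.Sum using (_⊎_; inj₁; inj₂)
open import Data.Nat using (ℕ; zero; suc; _+_; _*_; _∸_; _≤_; _<_; _≟_; _≤?_; z≤n; s≤s; s≤s⁻¹; ⌊_/2⌋; ⌈_/2⌉)
open import Data.Nat.Properties
open import Data.Nat.DivMod using (_/_; _%_; m≡m%n+[m/n]*n; m%n<n; m*n/n≡m; m<n⇒m%n≡m; m<n⇒m/n≡0; %-remove-+ˡ; +-distrib-/-∣ˡ)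
open import Data.Nat.Divisibility using (_∣_; divides; n∣m*n)
open import Data.Nat.Tactic.RingSolver using (solve-∀)
open import Data.List using ([]; _∷_; [_]; _++_; length; filter; upTo)
open import Data.List.Properties using (upTo-∷ʳ; filter-++; length-++)
open import Data.List.Membership.Propositional using (_∈_)
open import Data.List.Membership.Propositional.Properties using (∈-filter⁺; ∈-filter⁻; ∈-upTo⁺; ∈-upTo⁻)
open import Data.List.Relation.Unary.Any using (here; there)
open import Data.List.Relation.Unary.Unique.Propositional.Properties using (filter⁺; upTo⁺)
open import Relation.Nullary using (¬_; yes; no; does)
open import Relation.Nullary.Decidable using (_×-dec_)
open import Relation.Unary using (Pred; Decidable; _∪_; ∅)
open import Relation.Unary.Properties using (∁?; _∪?_; _∩?_; ∅?)
open import Relation.Binary.PropositionalEquality using (_≡_; refl; sym; trans; cong; cong₂; subst; subst₂; module ≡-Reasoning)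
open import Relation.Binary.Definitions using (tri<; tri≈; tri>)

variable
  P Q : Pred ℕ 0ℓ

count : Decidable P → ℕ → ℕ
count P? zero = 0
count P? (suc n) = if does (P? n) then suc (count P? n) else count P? n

count-cong : (P? : Decidable P) (Q? : Decidable Q) (N : ℕ) →
  (∀ {n} → n < N → P n → Q n) → (∀ {n} → n < N → Q n → P n) →
  count P? N ≡ count Q? N
count-cong P? Q? zero P⇒Q Q⇒P = refl
count-cong P? Q? (suc N) P⇒Q Q⇒P
  with P? N | Q? N | count-cong P? Q? N (P⇒Q ∘ m<n⇒m<1+n) (Q⇒P ∘ m<n⇒m<1+n)
... | yes _ | yes _ | ih = cong suc ih
... | no _  | no _  | ih = ih
... | yes p | no ¬q | _  = ⊥-elim (¬q (P⇒Q (n<1+n N) p))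
... | no ¬p | yes q | _  = ⊥-elim (¬p (Q⇒P (n<1+n N) q))

count-∪ : (P? : Decidable P) (Q? : Decidable Q) (N : ℕ) →
  (∀ {n} → n < N → P n → ¬ Q n) →
  count (P? ∪? Q?) N ≡ count P? N + count Q? N
count-∪ P? Q? zero _ = refl
count-∪ P? Q? (suc N) disjoint
  with P? N | Q? N | count-∪ P? Q? N (disjoint ∘ m<n⇒m<1+n)
... | yes p | yes q | _  = ⊥-elim (disjoint (n<1+n N) p q)
... | yes _ | no _  | ih = cong suc ih
... | no _  | yes _ | ih = trans (cong suc ih) (sym (+-suc _ _))
... | no _  | no _  | ih = ih

count-∁ : (P? : Decidable P) (N : ℕ) → count P? N + count (∁? P?) N ≡ N
count-∁ P? zero = refl
count-∁ P? (suc N) with P? N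
... | yes _ = cong suc (count-∁ P? N)
... | no _  = trans (+-suc _ _) (cong suc (count-∁ P? N))

count-+ : (P? : Decidable P) (x y : ℕ) →
  count P? (x + y) ≡ count P? x + count (λ i → P? (x + i)) y
count-+ P? x zero = trans (cong (count P?) (+-identityʳ x)) (sym (+-identityʳ _))
count-+ P? x (suc y) rewrite +-suc x y with P? (x + y)
... | yes _ = trans (cong suc (count-+ P? x y)) (sym (+-suc _ _))
... | no _  = count-+ P? x y

count-none : (P? : Decidable P) (N : ℕ) → (∀ {n} → n < N → ¬ P n) → count P? N ≡ 0
count-none P? zero _ = refl
count-none P? (suc N) none with P? N
... | yes p = ⊥-elim (none (n<1+n N) p)
... | no _  = count-none P? N (none ∘ m<n⇒m<1+n)

count-all : (P? : Decidable P) (N : ℕ) → (∀ {n} → n < N → P n) → count P? N ≡ N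
count-all P? zero _ = refl
count-all P? (suc N) all with P? N
... | yes _ = cong suc (count-all P? N (all ∘ m<n⇒m<1+n))
... | no ¬p = ⊥-elim (¬p (all (n<1+n N)))

count-interval : ∀ lo w N → lo + w < N → count ((lo ≤?_) ∩? (_≤? lo + w)) N ≡ suc w
count-interval lo w N lo+w<N = begin
  count I? N
    ≡⟨ cong (count I?) (sym N≡) ⟩
  count I? (lo + (suc w + z))
    ≡⟨ count-+ I? lo (suc w + z) ⟩
  count I? lo + count (λ i → I? (lo + i)) (suc w + z)
    ≡⟨ cong₂ _+_ (count-none I? lo below) (count-+ (λ i → I? (lo + i)) (suc w) z) ⟩
  count (λ i → I? (lo + i)) (suc w) + count (λ i → I? (lo + (suc w + i))) z
    ≡⟨ cong₂ _+_ (count-all _ (suc w) inside) (count-none _ z above) ⟩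
  suc w + 0
    ≡⟨ +-identityʳ (suc w) ⟩
  suc w ∎
  where
  open ≡-Reasoning
  I? = (lo ≤?_) ∩? (_≤? lo + w)
  z = N ∸ (lo + suc w)
  N≡ : lo + (suc w + z) ≡ N
  N≡ = trans (sym (+-assoc lo (suc w) z)) (m+[n∸m]≡n (subst (_≤ N) (sym (+-suc lo w)) lo+w<N))
  below : ∀ {i} → i < lo → ¬ (lo ≤ i × i ≤ lo + w)
  below i<lo (lo≤i , _) = <⇒≱ i<lo lo≤i
  inside : ∀ {i} → i < suc w → lo ≤ lo + i × lo + i ≤ lo + w
  inside {i} i<1+w = m≤m+n lo i , +-monoʳ-≤ lo (s≤s⁻¹ i<1+w)
  above : ∀ {i} → i < z → ¬ (lo ≤ lo + (suc w + i) × lo + (suc w + i) ≤ lo + w)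
  above {i} _ (_ , le) = <⇒≱ (+-monoʳ-< lo (s≤s (m≤m+n w i))) le

count-≟0 : ∀ N → count (_≟ 0) (suc N) ≡ 1
count-≟0 zero = refl
count-≟0 (suc N) = count-≟0 N

length-filter-upTo : (P? : Decidable P) (N : ℕ) → length (filter P? (upTo N)) ≡ count P? N
length-filter-upTo P? zero = refl
length-filter-upTo P? (suc N) = begin
  length (filter P? (upTo (suc N)))
    ≡⟨ cong (λ xs → length (filter P? xs)) (sym (upTo-∷ʳ N)) ⟩
  length (filter P? (upTo N ++ [ N ]))
    ≡⟨ cong length (filter-++ P? (upTo N) [ N ]) ⟩
  length (filter P? (upTo N) ++ filter P? [ N ])
    ≡⟨ length-++ (filter P? (upTo N)) ⟩
  length (filter P? (upTo N)) + length (filter P? [ N ])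
    ≡⟨ cong (_+ length (filter P? [ N ])) (length-filter-upTo P? N) ⟩
  count P? N + length (filter P? [ N ])
    ≡⟨ last ⟩
  count P? (suc N) ∎
  where
  open ≡-Reasoning
  last : count P? N + length (filter P? [ N ]) ≡ count P? (suc N)
  last with P? N
  ... | yes _ = +-comm (count P? N) 1
  ... | no _  = +-identityʳ (count P? N)

hasGenus-count : ∀ {S : Pred ℕ 0ℓ} (Q? : Decidable Q) (t : ℕ) →
  (∀ {n} → t ≤ n → S n) → (∀ {n} → n < t → S n → Q n) → (∀ {n} → Q n → S n) →
  HasGenus S (count (∁? Q?) t)
hasGenus-count {S = S} Q? t ≥t⇒S S⇒Q Q⇒S =
  filter (∁? Q?) (upTo t) , filter⁺ (∁? Q?) (upTo⁺ t) , notInS , complete , length-filter-upTo (∁? Q?) t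
  where
  notInS : ∀ n → n ∈ filter (∁? Q?) (upTo t) → ¬ S n
  notInS n n∈ Sn with ∈-filter⁻ (∁? Q?) n∈
  ... | n∈upTo , ¬Qn = ¬Qn (S⇒Q (∈-upTo⁻ n∈upTo) Sn)
  complete : ∀ n → ¬ S n → n ∈ filter (∁? Q?) (upTo t)
  complete n ¬Sn = ∈-filter⁺ (∁? Q?) (∈-upTo⁺ (≰⇒> (¬Sn ∘ ≥t⇒S))) (¬Sn ∘ Q⇒S)

j*2≤n⇒j≤⌊n/2⌋ : ∀ {j n} → j * 2 ≤ n → j ≤ ⌊ n /2⌋
j*2≤n⇒j≤⌊n/2⌋ {zero} _ = z≤n
j*2≤n⇒j≤⌊n/2⌋ {suc j} (s≤s (s≤s j*2≤n)) = s≤s (j*2≤n⇒j≤⌊n/2⌋ j*2≤n)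

j≤⌊n/2⌋⇒j*2≤n : ∀ {j n} → j ≤ ⌊ n /2⌋ → j * 2 ≤ n
j≤⌊n/2⌋⇒j*2≤n {zero} _ = z≤n
j≤⌊n/2⌋⇒j*2≤n {suc j} {suc (suc n)} (s≤s j≤⌊n/2⌋) = s≤s (s≤s (j≤⌊n/2⌋⇒j*2≤n j≤⌊n/2⌋))

⌊n*2/2⌋≡n : ∀ n → ⌊ n * 2 /2⌋ ≡ n
⌊n*2/2⌋≡n zero = refl
⌊n*2/2⌋≡n (suc n) = cong suc (⌊n*2/2⌋≡n n)

⌈n*2/2⌉≡n : ∀ n → ⌈ n * 2 /2⌉ ≡ n
⌈n*2/2⌉≡n zero = refl
⌈n*2/2⌉≡n (suc n) = cong suc (⌈n*2/2⌉≡n n)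

-- For p = k * 2 these are q = p/2 + 4, M = μ p, Γ = γ p and t = p * μ p (see μ-even, γ-even).
module Semigroup (k : ℕ) where

  q M Γ t : ℕ
  q = 4 + k
  M = 2 + k * q
  Γ = k * (2 * k + 7)
  t = k * 2 * M

  Sg : Pred ℕ 0ℓ
  Sg = ⟨ M ∷ Γ ∷ suc Γ ∷ [] ⟩[ t ]

  Γ+q≡2*M : Γ + q ≡ 2 * M
  Γ+q≡2*M = identity k
    where
    identity : ∀ k → k * (2 * k + 7) + (4 + k) ≡ 2 * (2 + k * (4 + k))
    identity = solve-∀

  record Combination (n : ℕ) : Set where
    constructor combination
    field
      a b c : ℕ
      n≡ : n ≡ a * M + b * Γ + c * suc Γ

  combination-+ : ∀ {m n} → Combination m → Combination n → Combination (m + n)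
  combination-+ (combination a b c m≡) (combination a′ b′ c′ n≡) =
    combination (a + a′) (b + b′) (c + c′) (trans (cong₂ _+_ m≡ n≡) (regroup a b c a′ b′ c′ M Γ))
    where
    regroup : ∀ a b c a′ b′ c′ M Γ →
      a * M + b * Γ + c * suc Γ + (a′ * M + b′ * Γ + c′ * suc Γ) ≡
      (a + a′) * M + (b + b′) * Γ + (c + c′) * suc Γ
    regroup = solve-∀

  Sg⇒Combination⊎t≤ : ∀ {n} → Sg n → Combination n ⊎ t ≤ n
  Sg⇒Combination⊎t≤ zero∈ = inj₁ (combination 0 0 0 refl)
  Sg⇒Combination⊎t≤ (gen∈ (here refl)) = inj₁ (combination 1 0 0 (first M Γ))
    where
    first : ∀ x y → x ≡ 1 * x + 0 * y + 0 * suc y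
    first = solve-∀
  Sg⇒Combination⊎t≤ (gen∈ (there (here refl))) = inj₁ (combination 0 1 0 (second M Γ))
    where
    second : ∀ x y → y ≡ 0 * x + 1 * y + 0 * suc y
    second = solve-∀
  Sg⇒Combination⊎t≤ (gen∈ (there (there (here refl)))) = inj₁ (combination 0 0 1 (third M Γ))
    where
    third : ∀ x y → suc y ≡ 0 * x + 0 * y + 1 * suc y
    third = solve-∀
  Sg⇒Combination⊎t≤ (≥t∈ t≤n) = inj₂ t≤n
  Sg⇒Combination⊎t≤ (+∈ {m} {n} Sm Sn) with Sg⇒Combination⊎t≤ Sm | Sg⇒Combination⊎t≤ Sn
  ... | inj₁ x | inj₁ y  = inj₁ (combination-+ x y)
  ... | inj₂ t≤m | _     = inj₂ (≤-trans t≤m (m≤m+n m n))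
  ... | inj₁ _ | inj₂ t≤n = inj₂ (≤-trans t≤n (m≤n+m n m))

  multiple∈Sg : ∀ {g} → Sg g → ∀ x → Sg (x * g)
  multiple∈Sg _ zero = zero∈
  multiple∈Sg g∈ (suc x) = +∈ g∈ (multiple∈Sg g∈ x)

  Combination⇒Sg : ∀ {n} → Combination n → Sg n
  Combination⇒Sg (combination a b c refl) =
    +∈ (+∈ (multiple∈Sg (gen∈ (here refl)) a) (multiple∈Sg (gen∈ (there (here refl))) b))
       (multiple∈Sg (gen∈ (there (there (here refl)))) c)

  combination-shape : ∀ a b c →
    a * M + b * Γ + c * suc Γ + (b + c) * q ≡ (a + (b + c) * 2) * M + c
  combination-shape a b c = begin
    a * M + b * Γ + c * suc Γ + (b + c) * q ≡⟨ regroup a b c M Γ q ⟩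
    a * M + (b + c) * (Γ + q) + c           ≡⟨ cong (λ x → a * M + (b + c) * x + c) Γ+q≡2*M ⟩
    a * M + (b + c) * (2 * M) + c           ≡⟨ collect a (b + c) c M ⟩
    (a + (b + c) * 2) * M + c               ∎
    where
    open ≡-Reasoning
    regroup : ∀ a b c M Γ q → a * M + b * Γ + c * suc Γ + (b + c) * q ≡ a * M + (b + c) * (Γ + q) + c
    regroup = solve-∀
    collect : ∀ a j c M → a * M + j * (2 * M) + c ≡ (a + j * 2) * M + c
    collect = solve-∀

  t≤[1+k]*Γ : t ≤ suc k * Γ
  t≤[1+k]*Γ = ≤-trans (m≤m+n t (k * (k + 3))) (≤-reflexive (sym (identity k)))
    where
    identity : ∀ k → suc k * (k * (2 * k + 7)) ≡ k * 2 * (2 + k * (4 + k)) + k * (k + 3)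
    identity = solve-∀

  t+J*q≤J*2*M : ∀ {J} → k < J → t + J * q ≤ J * 2 * M
  t+J*q≤J*2*M {J} k<J = begin
    t + J * q     ≤⟨ +-monoˡ-≤ (J * q) (≤-trans t≤[1+k]*Γ (*-monoˡ-≤ Γ k<J)) ⟩
    J * Γ + J * q ≡⟨ sym (*-distribˡ-+ J Γ q) ⟩
    J * (Γ + q)   ≡⟨ cong (J *_) Γ+q≡2*M ⟩
    J * (2 * M)   ≡⟨ sym (*-assoc J 2 M) ⟩
    J * 2 * M     ∎
    where open ≤-Reasoning

  J*q<M : ∀ {J} → J ≤ k → J * q < M
  J*q<M J≤k = s≤s (m≤n⇒m≤1+n (*-monoˡ-≤ q J≤k))

  normal-form-bound : ∀ {n J A C} → n < t → J * 2 ≤ A → n + J * q ≡ A * M + C → J ≤ k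
  normal-form-bound {n} {J} {A} {C} n<t J*2≤A eq = ≮⇒≥ λ k<J → <⇒≱ n<t (+-cancelʳ-≤ (J * q) t n (begin
    t + J * q ≤⟨ t+J*q≤J*2*M k<J ⟩
    J * 2 * M ≤⟨ *-monoˡ-≤ M J*2≤A ⟩
    A * M     ≤⟨ m≤m+n (A * M) C ⟩
    A * M + C ≡⟨ sym eq ⟩
    n + J * q ∎))
    where open ≤-Reasoning

  Window : ℕ → Pred ℕ 0ℓ
  Window J r = M ≤ r + J * q × r + J * q ≤ M + J

  Window? : ∀ J → Decidable (Window J)
  Window? J r = M ≤? r + J * q ×-dec r + J * q ≤? M + J

  Windows : ℕ → Pred ℕ 0ℓ
  Windows zero = ∅
  Windows (suc h) = Windows h ∪ Window (suc h)

  Windows? : ∀ h → Decidable (Windows h)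
  Windows? zero = ∅?
  Windows? (suc h) = Windows? h ∪? Window? (suc h)

  Block : ℕ → Pred ℕ 0ℓ
  Block h = (_≡ 0) ∪ Windows h

  Block? : ∀ h → Decidable (Block h)
  Block? h = (_≟ 0) ∪? Windows? h

  Member : Pred ℕ 0ℓ
  Member n = Block ⌈ n / M /2⌉ (n % M)

  Member? : Decidable Member
  Member? n = Block? ⌈ n / M /2⌉ (n % M)

  Windows-intro : ∀ {h J r} → r < M → J ≤ h → Window J r → Windows h r
  Windows-intro {J = zero} r<M _ (M≤r+0 , _) = ⊥-elim (<⇒≱ r<M (subst (M ≤_) (+-identityʳ _) M≤r+0))
  Windows-intro {zero} {suc J} _ () _
  Windows-intro {suc h} {suc J} r<M J≤h w with m≤n⇒m<n∨m≡n J≤h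
  ... | inj₁ J<1+h = inj₁ (Windows-intro r<M (s≤s⁻¹ J<1+h) w)
  ... | inj₂ refl  = inj₂ w

  Windows-elim : ∀ {h r} → Windows h r → ∃[ J ] J ≤ h × Window J r
  Windows-elim {suc h} (inj₁ ws) with Windows-elim ws
  ... | J , J≤h , w = J , m≤n⇒m≤1+n J≤h , w
  Windows-elim {suc h} (inj₂ w) = suc h , ≤-refl , w

  normal-form⇒Block : ∀ {m r J A C} → r < M → J ≤ k → C ≤ J → J * 2 ≤ A →
    m * M + r + J * q ≡ A * M + C → Block ⌈ m /2⌉ r
  normal-form⇒Block {m} {r} {J} {A} {C} r<M J≤k C≤J J*2≤A eq with <-cmp A (suc m)
  ... | tri< A<1+m _ _ = inj₁ (n≤0⇒n≡0 (+-cancelʳ-≤ (J * q) r 0 r+J*q≤J*q))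
    where
    open ≤-Reasoning
    r+J*q≤J*q : r + J * q ≤ J * q
    r+J*q≤J*q = begin
      r + J * q ≤⟨ +-cancelˡ-≤ (m * M) _ _ (begin
        m * M + (r + J * q) ≡⟨ sym (+-assoc (m * M) r (J * q)) ⟩
        m * M + r + J * q   ≡⟨ eq ⟩
        A * M + C           ≤⟨ +-monoˡ-≤ C (*-monoˡ-≤ M (s≤s⁻¹ A<1+m)) ⟩
        m * M + C           ∎) ⟩
      C         ≤⟨ C≤J ⟩
      J         ≤⟨ m≤m*n J q ⟩
      J * q     ∎
  ... | tri≈ _ refl _ = inj₂ (Windows-intro r<M (j*2≤n⇒j≤⌊n/2⌋ J*2≤A)
                               (subst (M ≤_) (sym r+J*q≡M+C) (m≤m+n M C) ,
                                subst (_≤ M + J) (sym r+J*q≡M+C) (+-monoʳ-≤ M C≤J)))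
    where
    open ≡-Reasoning
    r+J*q≡M+C : r + J * q ≡ M + C
    r+J*q≡M+C = +-cancelˡ-≡ (m * M) _ _ (begin
      m * M + (r + J * q) ≡⟨ sym (+-assoc (m * M) r (J * q)) ⟩
      m * M + r + J * q   ≡⟨ eq ⟩
      M + m * M + C       ≡⟨ cong (_+ C) (+-comm M (m * M)) ⟩
      m * M + M + C       ≡⟨ +-assoc (m * M) M C ⟩
      m * M + (M + C)     ∎)
  ... | tri> _ _ 1+m<A = ⊥-elim (<-irrefl eq (begin-strict
      m * M + r + J * q   ≡⟨ +-assoc (m * M) r (J * q) ⟩
      m * M + (r + J * q) <⟨ +-monoʳ-< (m * M) (+-mono-< r<M (J*q<M J≤k)) ⟩
      m * M + (M + M)     ≡⟨ +-comm (m * M) (M + M) ⟩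
      M + M + m * M       ≡⟨ +-assoc M M (m * M) ⟩
      suc (suc m) * M     ≤⟨ *-monoˡ-≤ M 1+m<A ⟩
      A * M               ≤⟨ m≤m+n (A * M) C ⟩
      A * M + C           ∎))
    where open ≤-Reasoning

  Combination⇒Block : ∀ {m r} → r < M → m * M + r < t → Combination (m * M + r) → Block ⌈ m /2⌉ r
  Combination⇒Block {m} {r} r<M n<t (combination a b c n≡) =
    normal-form⇒Block {m} {r} r<M (normal-form-bound n<t J*2≤A eq) (m≤n+m c b) J*2≤A eq
    where
    J*2≤A : (b + c) * 2 ≤ a + (b + c) * 2
    J*2≤A = m≤n+m ((b + c) * 2) a
    eq : m * M + r + (b + c) * q ≡ (a + (b + c) * 2) * M + c
    eq = trans (cong (_+ (b + c) * q) n≡) (combination-shape a b c)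

  window⇒Combination : ∀ {m r J} → J * 2 ≤ suc m → Window J r → Combination (m * M + r)
  window⇒Combination {m} {r} {J} J*2≤1+m (M≤r+J*q , r+J*q≤M+J) =
    combination a b c (sym (+-cancelʳ-≡ (J * q) _ _ eq))
    where
    c = r + J * q ∸ M
    b = J ∸ c
    a = suc m ∸ J * 2
    b+c≡J : b + c ≡ J
    b+c≡J = m∸n+n≡m (m≤n+o⇒m∸n≤o (r + J * q) M r+J*q≤M+J)
    open ≡-Reasoning
    eq : a * M + b * Γ + c * suc Γ + J * q ≡ m * M + r + J * q
    eq = begin
      a * M + b * Γ + c * suc Γ + J * q       ≡⟨ cong (λ j → a * M + b * Γ + c * suc Γ + j * q) (sym b+c≡J) ⟩
      a * M + b * Γ + c * suc Γ + (b + c) * q ≡⟨ combination-shape a b c ⟩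
      (a + (b + c) * 2) * M + c               ≡⟨ cong (λ j → (a + j * 2) * M + c) b+c≡J ⟩
      (a + J * 2) * M + c                     ≡⟨ cong (λ x → x * M + c) (m∸n+n≡m J*2≤1+m) ⟩
      M + m * M + c                           ≡⟨ cong (_+ c) (+-comm M (m * M)) ⟩
      m * M + M + c                           ≡⟨ +-assoc (m * M) M c ⟩
      m * M + (M + c)                         ≡⟨ cong (m * M +_) (m+[n∸m]≡n M≤r+J*q) ⟩
      m * M + (r + J * q)                     ≡⟨ sym (+-assoc (m * M) r (J * q)) ⟩
      m * M + r + J * q                       ∎

  Block⇒Combination : ∀ {m r} → Block ⌈ m /2⌉ r → Combination (m * M + r)
  Block⇒Combination {m} (inj₁ refl) = combination m 0 0 (sym (+-identityʳ (m * M + 0)))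
  Block⇒Combination {m} {r} (inj₂ ws) with Windows-elim ws
  ... | J , J≤h , w = window⇒Combination {m} {r} (j≤⌊n/2⌋⇒j*2≤n J≤h) w

  decomposition : ∀ n → n ≡ n / M * M + n % M
  decomposition n = trans (m≡m%n+[m/n]*n n M) (+-comm (n % M) _)

  Sg⇒Member : ∀ {n} → n < t → Sg n → Member n
  Sg⇒Member {n} n<t Sn with Sg⇒Combination⊎t≤ Sn
  ... | inj₂ t≤n = ⊥-elim (<⇒≱ n<t t≤n)
  ... | inj₁ x = Combination⇒Block {n / M} {n % M} (m%n<n n M) (subst (_< t) (decomposition n) n<t)
                   (subst Combination (decomposition n) x)

  Member⇒Sg : ∀ {n} → Member n → Sg n
  Member⇒Sg {n} b = subst Sg (sym (decomposition n)) (Combination⇒Sg (Block⇒Combination {n / M} {n % M} b))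

  window-disjoint : ∀ {J J′ r} → J < J′ → J′ ≤ k → Window J r → ¬ Window J′ r
  window-disjoint {J} {J′} {r} J<J′ J′≤k (M≤r+J*q , _) (_ , r+J′*q≤M+J′) =
    <⇒≱ (≤-<-trans J′≤k (m<n+m k {4} (s≤s z≤n))) (+-cancelˡ-≤ (r + J * q) q J′ (begin
      r + J * q + q     ≡⟨ +-assoc r (J * q) q ⟩
      r + (J * q + q)   ≡⟨ cong (r +_) (+-comm (J * q) q) ⟩
      r + suc J * q     ≤⟨ +-monoʳ-≤ r (*-monoˡ-≤ q J<J′) ⟩
      r + J′ * q        ≤⟨ r+J′*q≤M+J′ ⟩
      M + J′            ≤⟨ +-monoˡ-≤ J′ M≤r+J*q ⟩
      r + J * q + J′    ∎))
    where open ≤-Reasoning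

  window-count : ∀ {j} → suc j ≤ k → count (Window? (suc j)) M ≡ suc (suc j)
  window-count {j} J≤k =
    trans (count-cong (Window? J) ((lo ≤?_) ∩? (_≤? lo + J)) M (λ _ → to) (λ _ → from))
          (count-interval lo J M lo+J<M)
    where
    J = suc j
    lo = M ∸ J * q
    lo+J*q≡M : lo + J * q ≡ M
    lo+J*q≡M = m∸n+n≡m (<⇒≤ (J*q<M J≤k))
    M+J≡lo+J+J*q : M + J ≡ lo + J + J * q
    M+J≡lo+J+J*q = trans (cong (_+ J) (sym lo+J*q≡M)) (trans (+-assoc lo (J * q) J)
                     (trans (cong (lo +_) (+-comm (J * q) J)) (sym (+-assoc lo J (J * q)))))
    to : ∀ {r} → Window J r → lo ≤ r × r ≤ lo + J
    to {r} (M≤r+J*q , r+J*q≤M+J) =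
      +-cancelʳ-≤ (J * q) lo r (subst (_≤ r + J * q) (sym lo+J*q≡M) M≤r+J*q) ,
      +-cancelʳ-≤ (J * q) r (lo + J) (subst (r + J * q ≤_) M+J≡lo+J+J*q r+J*q≤M+J)
    from : ∀ {r} → lo ≤ r × r ≤ lo + J → Window J r
    from {r} (lo≤r , r≤lo+J) =
      subst (_≤ r + J * q) lo+J*q≡M (+-monoˡ-≤ (J * q) lo≤r) ,
      subst (r + J * q ≤_) (sym M+J≡lo+J+J*q) (+-monoˡ-≤ (J * q) r≤lo+J)
    lo+J<M : lo + J < M
    lo+J<M = subst (lo + J <_) lo+J*q≡M (+-monoʳ-< lo (m<m*n J q (s≤s (s≤s z≤n))))

  windows-count : ∀ h → h ≤ k → count (Windows? h) M * 2 ≡ h * (h + 3)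
  windows-count zero _ = cong (_* 2) (count-none ∅? M λ _ ())
  windows-count (suc h) 1+h≤k = begin
    count (Windows? h ∪? Window? (suc h)) M * 2
      ≡⟨ cong (_* 2) (count-∪ (Windows? h) (Window? (suc h)) M (λ _ → disjoint)) ⟩
    (count (Windows? h) M + count (Window? (suc h)) M) * 2
      ≡⟨ *-distribʳ-+ 2 (count (Windows? h) M) _ ⟩
    count (Windows? h) M * 2 + count (Window? (suc h)) M * 2
      ≡⟨ cong₂ _+_ (windows-count h (<⇒≤ 1+h≤k)) (cong (_* 2) (window-count 1+h≤k)) ⟩
    h * (h + 3) + suc (suc h) * 2
      ≡⟨ identity h ⟩
    suc h * (suc h + 3) ∎
    where
    open ≡-Reasoning
    disjoint : ∀ {r} → Windows h r → ¬ Window (suc h) r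
    disjoint ws with Windows-elim ws
    ... | J , J≤h , w = window-disjoint (s≤s J≤h) 1+h≤k w
    identity : ∀ h → h * (h + 3) + suc (suc h) * 2 ≡ suc h * (suc h + 3)
    identity = solve-∀

  block-count : ∀ h → h ≤ k → count (Block? h) M * 2 ≡ 2 + h * (h + 3)
  block-count h h≤k = begin
    count ((_≟ 0) ∪? Windows? h) M * 2
      ≡⟨ cong (_* 2) (count-∪ (_≟ 0) (Windows? h) M (λ { _ refl → 0∉Windows })) ⟩
    (count (_≟ 0) M + count (Windows? h) M) * 2
      ≡⟨ *-distribʳ-+ 2 (count (_≟ 0) M) _ ⟩
    count (_≟ 0) M * 2 + count (Windows? h) M * 2
      ≡⟨ cong₂ _+_ (cong (_* 2) (count-≟0 (suc (k * q)))) (windows-count h h≤k) ⟩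
    2 + h * (h + 3) ∎
    where
    open ≡-Reasoning
    0∉Windows : ¬ Windows h 0
    0∉Windows ws with Windows-elim ws
    ... | J , J≤h , (M≤J*q , _) = <⇒≱ (J*q<M (≤-trans J≤h h≤k)) M≤J*q

  block-coordinates : ∀ i {r} → r < M → (i * M + r) / M ≡ i × (i * M + r) % M ≡ r
  block-coordinates i {r} r<M =
    trans (+-distrib-/-∣ˡ r (n∣m*n i)) (trans (cong₂ _+_ (m*n/n≡m i M) (m<n⇒m/n≡0 r<M)) (+-identityʳ i)) ,
    trans (%-remove-+ˡ r (n∣m*n i)) (m<n⇒m%n≡m r<M)

  block-members : ∀ {x h} i → x ≡ i * M → ⌈ i /2⌉ ≡ h →
    count (λ r → Member? (x + r)) M ≡ count (Block? h) M
  block-members i refl refl = count-cong (λ r → Member? (i * M + r)) (Block? ⌈ i /2⌉) M to from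
    where
    to : ∀ {r} → r < M → Member (i * M + r) → Block ⌈ i /2⌉ r
    to r<M with block-coordinates i r<M
    ... | i≡ , r≡ = subst₂ (λ m r → Block ⌈ m /2⌉ r) i≡ r≡
    from : ∀ {r} → r < M → Block ⌈ i /2⌉ r → Member (i * M + r)
    from r<M with block-coordinates i r<M
    ... | i≡ , r≡ = subst₂ (λ m r → Block ⌈ m /2⌉ r) (sym i≡) (sym r≡)

  members-count : ∀ a → a ≤ k → count Member? (a * 2 * M) * 6 ≡ a * (2 * (a * a) + 9 * a + 13)
  members-count zero _ = refl
  members-count (suc a) 1+a≤k = begin
    count Member? (suc a * 2 * M) * 6
      ≡⟨ cong (λ y → count Member? y * 6) (split a M) ⟩
    count Member? (x + M + M) * 6
      ≡⟨ cong (_* 6) blocks ⟩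
    (count Member? x + count (Block? a) M + count (Block? (suc a)) M) * 6
      ≡⟨ regroup (count Member? x) (count (Block? a) M) (count (Block? (suc a)) M) ⟩
    count Member? x * 6 + count (Block? a) M * 2 * 3 + count (Block? (suc a)) M * 2 * 3
      ≡⟨ cong₂ (λ u v → u + v * 3 + count (Block? (suc a)) M * 2 * 3)
           (members-count a (<⇒≤ 1+a≤k)) (block-count a (<⇒≤ 1+a≤k)) ⟩
    a * (2 * (a * a) + 9 * a + 13) + (2 + a * (a + 3)) * 3 + count (Block? (suc a)) M * 2 * 3
      ≡⟨ cong (λ v → a * (2 * (a * a) + 9 * a + 13) + (2 + a * (a + 3)) * 3 + v * 3)
           (block-count (suc a) 1+a≤k) ⟩
    a * (2 * (a * a) + 9 * a + 13) + (2 + a * (a + 3)) * 3 + (2 + suc a * (suc a + 3)) * 3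
      ≡⟨ identity a ⟩
    suc a * (2 * (suc a * suc a) + 9 * suc a + 13) ∎
    where
    open ≡-Reasoning
    x = a * 2 * M
    split : ∀ a M → suc a * 2 * M ≡ a * 2 * M + M + M
    split = solve-∀
    blocks : count Member? (x + M + M) ≡ count Member? x + count (Block? a) M + count (Block? (suc a)) M
    blocks = begin
      count Member? (x + M + M)
        ≡⟨ count-+ Member? (x + M) M ⟩
      count Member? (x + M) + count (λ r → Member? (x + M + r)) M
        ≡⟨ cong (_+ count (λ r → Member? (x + M + r)) M) (count-+ Member? x M) ⟩
      count Member? x + count (λ r → Member? (x + r)) M + count (λ r → Member? (x + M + r)) M
        ≡⟨ cong₂ (λ u v → count Member? x + u + v)
             (block-members (a * 2) refl (⌈n*2/2⌉≡n a))
             (block-members (suc (a * 2)) (+-comm x M) (cong suc (⌊n*2/2⌋≡n a))) ⟩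
      count Member? x + count (Block? a) M + count (Block? (suc a)) M ∎
    regroup : ∀ c u v → (c + u + v) * 6 ≡ c * 6 + u * 2 * 3 + v * 2 * 3
    regroup = solve-∀
    identity : ∀ a → a * (2 * (a * a) + 9 * a + 13) + (2 + a * (a + 3)) * 3 + (2 + suc a * (suc a + 3)) * 3 ≡
                     suc a * (2 * (suc a * suc a) + 9 * suc a + 13)
    identity = solve-∀

  gaps-count : count (∁? Member?) t * 6 ≡ k * (10 * (k * k) + 39 * k + 11)
  gaps-count = +-cancelʳ-≡ (count Member? t * 6) _ _ (begin
    count (∁? Member?) t * 6 + count Member? t * 6
      ≡⟨ sym (*-distribʳ-+ 6 (count (∁? Member?) t) _) ⟩
    (count (∁? Member?) t + count Member? t) * 6
      ≡⟨ cong (_* 6) (trans (+-comm (count (∁? Member?) t) _) (count-∁ Member? t)) ⟩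
    t * 6
      ≡⟨ identity k ⟩
    k * (10 * (k * k) + 39 * k + 11) + k * (2 * (k * k) + 9 * k + 13)
      ≡⟨ cong (k * (10 * (k * k) + 39 * k + 11) +_) (sym (members-count k ≤-refl)) ⟩
    k * (10 * (k * k) + 39 * k + 11) + count Member? t * 6 ∎)
    where
    open ≡-Reasoning
    identity : ∀ k → k * 2 * (2 + k * (4 + k)) * 6 ≡
                     k * (10 * (k * k) + 39 * k + 11) + k * (2 * (k * k) + 9 * k + 13)
    identity = solve-∀

  Sg-genus : HasGenus Sg (count (∁? Member?) t)
  Sg-genus = hasGenus-count Member? t ≥t∈ Sg⇒Member Member⇒Sg

μ-even : ∀ k → μ (k * 2) ≡ Semigroup.M k
μ-even k = begin
  k * 2 * (k * 2) / 4 + 2 * (k * 2) + 2 ≡⟨ cong (λ x → x / 4 + 2 * (k * 2) + 2) (square k) ⟩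
  k * k * 4 / 4 + 2 * (k * 2) + 2       ≡⟨ cong (λ x → x + 2 * (k * 2) + 2) (m*n/n≡m (k * k) 4) ⟩
  k * k + 2 * (k * 2) + 2               ≡⟨ identity k ⟩
  2 + k * (4 + k)                       ∎
  where
  open ≡-Reasoning
  square : ∀ k → k * 2 * (k * 2) ≡ k * k * 4
  square = solve-∀
  identity : ∀ k → k * k + 2 * (k * 2) + 2 ≡ 2 + k * (4 + k)
  identity = solve-∀

γ-even : ∀ k → γ (k * 2) ≡ Semigroup.Γ k
γ-even k = begin
  2 * μ (k * 2) ∸ (k * 2 / 2 + 4)     ≡⟨ cong₂ (λ m h → 2 * m ∸ (h + 4)) (μ-even k) (m*n/n≡m k 2) ⟩
  2 * (2 + k * (4 + k)) ∸ (k + 4)     ≡⟨ cong (_∸ (k + 4)) (identity k) ⟩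
  k * (2 * k + 7) + (k + 4) ∸ (k + 4) ≡⟨ m+n∸n≡m (k * (2 * k + 7)) (k + 4) ⟩
  k * (2 * k + 7)                     ∎
  where
  open ≡-Reasoning
  identity : ∀ k → 2 * (2 + k * (4 + k)) ≡ k * (2 * k + 7) + (k + 4)
  identity = solve-∀

S-even : ∀ k → S (k * 2) ≡ Semigroup.Sg k
S-even k = cong₂ (λ m g → ⟨ m ∷ g ∷ suc g ∷ [] ⟩[ k * 2 * m ]) (μ-even k) (γ-even k)

genus-formula : ∀ k g → g * 6 ≡ k * (10 * (k * k) + 39 * k + 11) →
  k * 2 * (5 * (k * 2 * (k * 2)) + 39 * (k * 2) + 22) / 24 ≡ g
genus-formula k g g*6≡ = trans (cong (_/ 24) numerator≡g*24) (m*n/n≡m g 24)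
  where
  open ≡-Reasoning
  identity : ∀ k → k * 2 * (5 * (k * 2 * (k * 2)) + 39 * (k * 2) + 22) ≡ k * (10 * (k * k) + 39 * k + 11) * 4
  identity = solve-∀
  numerator≡g*24 : k * 2 * (5 * (k * 2 * (k * 2)) + 39 * (k * 2) + 22) ≡ g * 24
  numerator≡g*24 = begin
    k * 2 * (5 * (k * 2 * (k * 2)) + 39 * (k * 2) + 22) ≡⟨ identity k ⟩
    k * (10 * (k * k) + 39 * k + 11) * 4                ≡⟨ cong (_* 4) (sym g*6≡) ⟩
    g * 6 * 4                                           ≡⟨ *-assoc g 6 4 ⟩
    g * 24                                              ∎

-- The hypothesis 0 < p is unused: S(0) = ℕ and the formula gives 0 for p = 0.
propositionA2 : (p : ℕ) → 0 < p → 2 ∣ p →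
    HasGenus (S p) ((p * (5 * (p * p) + 39 * p + 22)) / 24)
propositionA2 _ _ (divides k refl) =
  subst₂ HasGenus (sym (S-even k)) (sym (genus-formula k _ gaps-count)) Sg-genus
  where open Semigroup k
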